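{- Let $G$ be an interval graph, $c\ge1$ and $k\ge0$ integers, and let $S$ and $S'$ be $c$-colorable sets of size at least $k$ in $G$. If neither $S$ nor $S'$ is locked in $G[S \cup S']$, then $\mathrm{dist}_{\mathsf{TAR}_k}(S,S') = |S \triangle S'|$.
   Context: A set $S \subseteq V(H)$ is $c$-colorable in a graph $H$ if $H[S]$ has a proper $c$-coloring. For $c$-colorable sets $S,T$ of $G$, $S \leftrightarrow T$ under $\mathsf{TAR}_k$ means $|S|,|T|\ge k$ and $|S\triangle T|=1$. A $\mathsf{TAR}_k$-sequence of length $\ell$ is a sequence $\langle S_0,\dots,S_\ell\rangle$ of $c$-colorable sets of $G$ with $S_{i-1}\leftrightarrow S_i$ under $\mathsf{TAR}_k$; $\mathrm{dist}_{\mathsf{TAR}_k}(S,S')$ is the minimum length of such a sequence between $S$ and $S'$ in $G$ ($\infty$ if none). A $c$-colorable set $S$ is locked in a subgraph $H$ if it is an inclusion-maximal $c$-colorable set of $H$ and $|S|=k$. An interval graph is the intersection graph of closed intervals on the real line.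
   Formalization: The closed intervals representing the interval graph $G$ have rational endpoints rather than real ones. -}

module Defs where

open import Data.Nat using (ℕ; zero; suc; _≤_)
open import Data.Fin using (Fin)
open import Data.Fin.Subset using (Subset; _∈_; _⊆_; _∪_; _─_; ∣_∣)
open import Data.Rational as ℚ using (ℚ)
open import Data.Product using (Σ; _×_; ∃)
open import Relation.Binary.PropositionalEquality using (_≡_; _≢_)
open import Relation.Nullary using (¬_)

record Graph (n : ℕ) : Set₁ where
  field
    Adj   : Fin n → Fin n → Set
    sym   : ∀ {i j} → Adj i j → Adj j i
    irrefl : ∀ {i} → ¬ Adj i i
open Graph public

record Intervals (n : ℕ) : Set where
  field
    left  : Fin n → ℚ
    right : Fin n → ℚ
    wf    : ∀ i → left i ℚ.≤ right i
open Intervals public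

Meet : ∀ {n} → Intervals n → Fin n → Fin n → Set
Meet I i j = (left I i ℚ.≤ right I j) × (left I j ℚ.≤ right I i)

IsIntervalGraph : ∀ {n} → Graph n → Set
IsIntervalGraph {n} G =
  Σ (Intervals n) λ I → ∀ i j →
    (Adj G i j → (i ≢ j) × Meet I i j) × ((i ≢ j) × Meet I i j → Adj G i j)

Colorable : ∀ {n} → Graph n → ℕ → Subset n → Set
Colorable {n} G c S =
  Σ (Fin n → Fin c) λ f → ∀ i j → i ∈ S → j ∈ S → Adj G i j → f i ≢ f j

_△_ : ∀ {n} → Subset n → Subset n → Subset n
S △ T = (S ─ T) ∪ (T ─ S)

TARStep : ∀ {n} → ℕ → Subset n → Subset n → Set
TARStep k S T = (k ≤ ∣ S ∣) × (k ≤ ∣ T ∣) × (∣ S △ T ∣ ≡ 1)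

data TARSeq {n} (G : Graph n) (c k : ℕ) : Subset n → Subset n → ℕ → Set where
  [_]  : ∀ {S} → Colorable G c S → TARSeq G c k S S zero
  _∷_  : ∀ {S T U ℓ} → Colorable G c S → TARStep k S T →
         TARSeq G c k T U ℓ → TARSeq G c k S U (suc ℓ)

DistEq : ∀ {n} → Graph n → ℕ → ℕ → Subset n → Subset n → ℕ → Set
DistEq G c k S T d =
  TARSeq G c k S T d × (∀ ℓ → TARSeq G c k S T ℓ → d ≤ ℓ)

-- S is an inclusion-maximal c-colorable set of the subgraph G[H].
-- (Colorability in G[H] of a subset of H coincides with colorability in G.)
MaximalColorableIn : ∀ {n} → Graph n → ℕ → Subset n → Subset n → Set
MaximalColorableIn G c H S =
  S ⊆ H × Colorable G c S ×
  (∀ T → T ⊆ H → S ⊆ T → Colorable G c T → T ⊆ S)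

Locked : ∀ {n} → Graph n → ℕ → ℕ → Subset n → Subset n → Set
Locked G c k H S = MaximalColorableIn G c H S × (∣ S ∣ ≡ k)

-- Each TAR step changes S △ S′ by one vertex, so no sequence is shorter than ∣ S △ S′ ∣.
-- Conversely, interval graphs are perfect: a set is c-colorable iff no point lies in more than
-- c of its intervals (colour greedily by increasing right end). Walk from S towards S′: if one
-- side can absorb a vertex of the other and stay colorable, it does. Otherwise both sides have
-- more than k vertices; let x be the interval of S △ S′ with the leftmost right end, say x ∈ S′.
-- Replacing the interval of S \ S′ with the leftmost left end by x raises the depth of no point
-- beyond what S or S′ already has, so it is a deletion followed by an insertion through
-- colorable sets of size at least k. Every move brings the two sets one vertex closer.

module Submission where

open import Defs
open import Data.Nat using (ℕ; zero; suc; _+_; _≤_; _<_; _≟_; _≤?_; z≤n; s≤s)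
open import Data.Nat.Properties
  using (≤-trans; ≤-reflexive; ≤-antisym; ≤-pred; <⇒≤; <-trans; <-≤-trans; ≤-<-trans;
         ≤∧≢⇒<; ≤⇒≯; n≤1+n; +-suc; +-comm; +-monoʳ-≤; module ≤-Reasoning)
open import Data.Nat.Induction using (<-wellFounded)
open import Data.Fin as Fin using (Fin; zero; suc; fromℕ<)
open import Data.Fin.Properties using (any?; all?; ¬∀⟶∃¬; suc-injective; 0≢1+n) renaming (_≟_ to _≟ᶠ_)
open import Data.Fin.Subset
  using (Subset; inside; outside; _∈_; _∉_; _⊆_; _⊂_; _∪_; _∩_; _─_; _-_; ⁅_⁆; ⊤; ∣_∣; Nonempty; Empty)
open import Data.Fin.Subset.Properties
  using (_∈?_; nonempty?; ⊆-antisym; Empty-unique; ∣⊥∣≡0; ∣⊤∣≡n; ∈⊤; ∣⁅x⁆∣≡1; x∈⁅x⁆; x∈⁅y⁆⇒x≡y;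
         x∉⁅y⁆⇒x≢y; p⊆q⇒∣p∣≤∣q∣; x∈p⇒p-x⊂p; x∈p⇒∣p-x∣<∣p∣; x∈p∧x≢y⇒x∈p-y; x∈p∧x∉q⇒x∈p─q;
         p─q⊆p; x∈p∪q⁻; x∈p∪q⁺; p⊆p∪q; q⊆p∪q; ∣p∣≤∣p∪q∣; x∈p∩q⁻; x∈p∩q⁺; ∪-comm)
open import Data.Fin.Subset.Induction using (Acc; acc; ⊂-wellFounded)
open import Data.Vec.Base using (_∷_; []; here; there; tabulate)
open import Data.Vec.Properties using (lookup∘tabulate; []=⇒lookup; lookup⇒[]=)
open import Data.Vec.Functional using (updateAt)
open import Data.Vec.Functional.Properties using (updateAt-updates; updateAt-minimal)
open import Data.Rational as ℚ using (ℚ)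
import Data.Rational.Properties as ℚ
open import Data.Product using (∃; _×_; _,_; proj₁; proj₂; map₂)
open import Data.Sum as Sum using (_⊎_; inj₁; inj₂)
open import Function using (_∘_; const; id)
open import Relation.Binary.Bundles using (TotalPreorder)
open import Relation.Binary.PropositionalEquality as ≡ using (_≡_; _≢_; refl; cong; subst)
open import Relation.Nullary using (¬_; Dec; does; yes; no; contradiction; ¬?)
open import Relation.Nullary.Decidable using (map′; dec-true; _×-dec_; _→-dec_)
open import Relation.Unary using (Pred; Decidable)

private
  variable
    n : ℕ
    p q : Subset n
    x y : Fin n

x∈p─q⇒x∉q : x ∈ p ─ q → x ∉ q
x∈p─q⇒x∉q {p = inside ∷ _} {q = outside ∷ _} here ()
x∈p─q⇒x∉q {p = _ ∷ _} {q = _ ∷ _} (there x∈p─q) (there x∈q) = x∈p─q⇒x∉q x∈p─q x∈q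

x∈p─q⁻ : x ∈ p ─ q → x ∈ p × x ∉ q
x∈p─q⁻ {p = p} {q = q} x∈p─q = p─q⊆p p q x∈p─q , x∈p─q⇒x∉q x∈p─q

x∈p-y⁻ : x ∈ p - y → x ∈ p × x ≢ y
x∈p-y⁻ = map₂ x∉⁅y⁆⇒x≢y ∘ x∈p─q⁻

x∈p∪⁅y⁆⁻ : x ∈ p ∪ ⁅ y ⁆ → x ∈ p ⊎ x ≡ y
x∈p∪⁅y⁆⁻ {p = p} {y = y} = Sum.map₂ (x∈⁅y⁆⇒x≡y y) ∘ x∈p∪q⁻ p ⁅ y ⁆

p⊆q⇒p∪⁅x⁆⊆q : p ⊆ q → x ∈ q → p ∪ ⁅ x ⁆ ⊆ q
p⊆q⇒p∪⁅x⁆⊆q p⊆q x∈q y∈ with x∈p∪⁅y⁆⁻ y∈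
... | inj₁ y∈p  = p⊆q y∈p
... | inj₂ refl = x∈q

∣p∪q∣≤∣p∣+∣q∣ : ∀ (p q : Subset n) → ∣ p ∪ q ∣ ≤ ∣ p ∣ + ∣ q ∣
∣p∪q∣≤∣p∣+∣q∣ []            []            = z≤n
∣p∪q∣≤∣p∣+∣q∣ (outside ∷ p) (outside ∷ q) = ∣p∪q∣≤∣p∣+∣q∣ p q
∣p∪q∣≤∣p∣+∣q∣ (inside  ∷ p) (outside ∷ q) = s≤s (∣p∪q∣≤∣p∣+∣q∣ p q)
∣p∪q∣≤∣p∣+∣q∣ (outside ∷ p) (inside  ∷ q) =
  ≤-trans (s≤s (∣p∪q∣≤∣p∣+∣q∣ p q)) (≤-reflexive (≡.sym (+-suc ∣ p ∣ ∣ q ∣)))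
∣p∪q∣≤∣p∣+∣q∣ (inside  ∷ p) (inside  ∷ q) =
  s≤s (≤-trans (∣p∪q∣≤∣p∣+∣q∣ p q) (+-monoʳ-≤ ∣ p ∣ (n≤1+n ∣ q ∣)))

∣p∣≤1+∣p-x∣ : ∀ (p : Subset n) x → ∣ p ∣ ≤ suc ∣ p - x ∣
∣p∣≤1+∣p-x∣ p x = begin
  ∣ p ∣                  ≤⟨ p⊆q⇒∣p∣≤∣q∣ p⊆p-x∪⁅x⁆ ⟩
  ∣ (p - x) ∪ ⁅ x ⁆ ∣    ≤⟨ ∣p∪q∣≤∣p∣+∣q∣ (p - x) ⁅ x ⁆ ⟩
  ∣ p - x ∣ + ∣ ⁅ x ⁆ ∣  ≡⟨ cong (∣ p - x ∣ +_) (∣⁅x⁆∣≡1 x) ⟩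
  ∣ p - x ∣ + 1          ≡⟨ +-comm ∣ p - x ∣ 1 ⟩
  suc ∣ p - x ∣          ∎
  where
  open ≤-Reasoning
  p⊆p-x∪⁅x⁆ : p ⊆ (p - x) ∪ ⁅ x ⁆
  p⊆p-x∪⁅x⁆ {y} y∈p with y ≟ᶠ x
  ... | yes refl = q⊆p∪q (p - x) ⁅ x ⁆ (x∈⁅x⁆ x)
  ... | no y≢x   = p⊆p∪q ⁅ x ⁆ (x∈p∧x≢y⇒x∈p-y y∈p y≢x)

m<∣p∣⇒m≤∣p-x∣ : ∀ {m} (p : Subset n) x → m < ∣ p ∣ → m ≤ ∣ p - x ∣
m<∣p∣⇒m≤∣p-x∣ p x m<∣p∣ = ≤-pred (<-≤-trans m<∣p∣ (∣p∣≤1+∣p-x∣ p x))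

x∉p⇒∣p∣<∣p∪⁅x⁆∣ : x ∉ p → ∣ p ∣ < ∣ p ∪ ⁅ x ⁆ ∣
x∉p⇒∣p∣<∣p∪⁅x⁆∣ {x = x} {p = p} x∉p =
  ≤-<-trans (p⊆q⇒∣p∣≤∣q∣ p⊆) (x∈p⇒∣p-x∣<∣p∣ (q⊆p∪q p ⁅ x ⁆ (x∈⁅x⁆ x)))
  where
  p⊆ : p ⊆ (p ∪ ⁅ x ⁆) - x
  p⊆ y∈p = x∈p∧x≢y⇒x∈p-y (p⊆p∪q ⁅ x ⁆ y∈p) λ { refl → x∉p y∈p }

x∈p⊆⁅x⁆⇒∣p∣≡1 : x ∈ p → p ⊆ ⁅ x ⁆ → ∣ p ∣ ≡ 1
x∈p⊆⁅x⁆⇒∣p∣≡1 {x = x} {p = p} x∈p p⊆⁅x⁆ =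
  ≡.trans (cong ∣_∣ (⊆-antisym p⊆⁅x⁆ ⁅x⁆⊆p)) (∣⁅x⁆∣≡1 x)
  where
  ⁅x⁆⊆p : ⁅ x ⁆ ⊆ p
  ⁅x⁆⊆p y∈⁅x⁆ = subst (_∈ p) (≡.sym (x∈⁅y⁆⇒x≡y x y∈⁅x⁆)) x∈p

injective⇒∣p∣≤∣q∣ : ∀ {m} {p : Subset n} {q : Subset m} (f : Fin n → Fin m) →
                    (∀ {x} → x ∈ p → f x ∈ q) →
                    (∀ {x y} → x ∈ p → y ∈ p → f x ≡ f y → x ≡ y) →
                    ∣ p ∣ ≤ ∣ q ∣
injective⇒∣p∣≤∣q∣ {p = []} f _ _ = z≤n
injective⇒∣p∣≤∣q∣ {p = outside ∷ p} f into inj =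
  injective⇒∣p∣≤∣q∣ (f ∘ suc) (into ∘ there) λ x∈ y∈ → suc-injective ∘ inj (there x∈) (there y∈)
injective⇒∣p∣≤∣q∣ {p = inside ∷ p} {q = q} f into inj =
  ≤-trans (s≤s (injective⇒∣p∣≤∣q∣ (f ∘ suc) into′ λ x∈ y∈ → suc-injective ∘ inj (there x∈) (there y∈)))
          (x∈p⇒∣p-x∣<∣p∣ (into here))
  where
  into′ : ∀ {x} → x ∈ p → f (suc x) ∈ q - f zero
  into′ x∈p = x∈p∧x≢y⇒x∈p-y (into (there x∈p)) λ fx≡f0 → 0≢1+n (inj here (there x∈p) (≡.sym fx≡f0))

x∈p△q⁻ : x ∈ p △ q → (x ∈ p × x ∉ q) ⊎ (x ∈ q × x ∉ p)
x∈p△q⁻ {p = p} {q = q} = Sum.map x∈p─q⁻ x∈p─q⁻ ∘ x∈p∪q⁻ (p ─ q) (q ─ p)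

x∈p△q⁺ˡ : x ∈ p → x ∉ q → x ∈ p △ q
x∈p△q⁺ˡ x∈p x∉q = x∈p∪q⁺ (inj₁ (x∈p∧x∉q⇒x∈p─q x∈p x∉q))

x∈p△q⁺ʳ : x ∈ q → x ∉ p → x ∈ p △ q
x∈p△q⁺ʳ x∈q x∉p = x∈p∪q⁺ (inj₂ (x∈p∧x∉q⇒x∈p─q x∈q x∉p))

∣p△q∣≡∣q△p∣ : ∀ (p q : Subset n) → ∣ p △ q ∣ ≡ ∣ q △ p ∣
∣p△q∣≡∣q△p∣ p q = cong ∣_∣ (∪-comm (p ─ q) (q ─ p))

Empty[p△q]⇒p≡q : Empty (p △ q) → p ≡ q
Empty[p△q]⇒p≡q {p = p} {q = q} empty = ⊆-antisym p⊆q q⊆p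
  where
  p⊆q : p ⊆ q
  p⊆q {x} x∈p with x ∈? q
  ... | yes x∈q = x∈q
  ... | no x∉q  = contradiction (x , x∈p△q⁺ˡ x∈p x∉q) empty
  q⊆p : q ⊆ p
  q⊆p {x} x∈q with x ∈? p
  ... | yes x∈p = x∈p
  ... | no x∉p  = contradiction (x , x∈p△q⁺ʳ x∈q x∉p) empty

∣p△p∣≡0 : ∀ (p : Subset n) → ∣ p △ p ∣ ≡ 0
∣p△p∣≡0 {n} p = ≡.trans (cong ∣_∣ (Empty-unique empty)) (∣⊥∣≡0 n)
  where
  empty : Empty (p △ p)
  empty (x , x∈p△p) = Sum.[ contradict , contradict ] (x∈p△q⁻ x∈p△p)
    where contradict = λ (x∈p , x∉p) → x∉p x∈p

∣p△r∣≤∣p△q∣+∣q△r∣ : ∀ (p q r : Subset n) → ∣ p △ r ∣ ≤ ∣ p △ q ∣ + ∣ q △ r ∣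
∣p△r∣≤∣p△q∣+∣q△r∣ p q r =
  ≤-trans (p⊆q⇒∣p∣≤∣q∣ p△r⊆) (∣p∪q∣≤∣p∣+∣q∣ (p △ q) (q △ r))
  where
  p△r⊆ : p △ r ⊆ (p △ q) ∪ (q △ r)
  p△r⊆ {x} x∈p△r with x∈p△q⁻ x∈p△r | x ∈? q
  ... | inj₁ (x∈p , x∉r) | yes x∈q = q⊆p∪q (p △ q) _ (x∈p△q⁺ˡ x∈q x∉r)
  ... | inj₁ (x∈p , x∉r) | no x∉q  = p⊆p∪q _ (x∈p△q⁺ˡ x∈p x∉q)
  ... | inj₂ (x∈r , x∉p) | yes x∈q = p⊆p∪q _ (x∈p△q⁺ʳ x∈q x∉p)
  ... | inj₂ (x∈r , x∉p) | no x∉q  = q⊆p∪q (p △ q) _ (x∈p△q⁺ʳ x∈r x∉q)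

∣p△p∪⁅x⁆∣≡1 : x ∉ p → ∣ p △ (p ∪ ⁅ x ⁆) ∣ ≡ 1
∣p△p∪⁅x⁆∣≡1 {x = x} {p = p} x∉p =
  x∈p⊆⁅x⁆⇒∣p∣≡1 (x∈p△q⁺ʳ (q⊆p∪q p ⁅ x ⁆ (x∈⁅x⁆ x)) x∉p) ⊆⁅x⁆
  where
  ⊆⁅x⁆ : p △ (p ∪ ⁅ x ⁆) ⊆ ⁅ x ⁆
  ⊆⁅x⁆ y∈ with x∈p△q⁻ y∈
  ... | inj₁ (y∈p , y∉p∪⁅x⁆) = contradiction (p⊆p∪q ⁅ x ⁆ y∈p) y∉p∪⁅x⁆
  ... | inj₂ (y∈p∪⁅x⁆ , y∉p) with x∈p∪⁅y⁆⁻ y∈p∪⁅x⁆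
  ...   | inj₁ y∈p  = contradiction y∈p y∉p
  ...   | inj₂ refl = x∈⁅x⁆ x

∣p△p-x∣≡1 : x ∈ p → ∣ p △ (p - x) ∣ ≡ 1
∣p△p-x∣≡1 {x = x} {p = p} x∈p =
  x∈p⊆⁅x⁆⇒∣p∣≡1 (x∈p△q⁺ˡ x∈p λ x∈p-x → proj₂ (x∈p-y⁻ x∈p-x) refl) ⊆⁅x⁆
  where
  ⊆⁅x⁆ : p △ (p - x) ⊆ ⁅ x ⁆
  ⊆⁅x⁆ {y} y∈ with x∈p△q⁻ y∈ | y ≟ᶠ x
  ... | _                  | yes refl = x∈⁅x⁆ x
  ... | inj₁ (y∈p , y∉p-x) | no y≢x   = contradiction (x∈p∧x≢y⇒x∈p-y y∈p y≢x) y∉p-x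
  ... | inj₂ (y∈p-x , y∉p) | no _     = contradiction (proj₁ (x∈p-y⁻ y∈p-x)) y∉p

∣p∪⁅x⁆△q∣<∣p△q∣ : x ∉ p → x ∈ q → ∣ (p ∪ ⁅ x ⁆) △ q ∣ < ∣ p △ q ∣
∣p∪⁅x⁆△q∣<∣p△q∣ {x = x} {p = p} {q = q} x∉p x∈q =
  ≤-<-trans (p⊆q⇒∣p∣≤∣q∣ ⊆p△q-x) (x∈p⇒∣p-x∣<∣p∣ (x∈p△q⁺ʳ x∈q x∉p))
  where
  ⊆p△q-x : (p ∪ ⁅ x ⁆) △ q ⊆ (p △ q) - x
  ⊆p△q-x y∈ with x∈p△q⁻ y∈
  ... | inj₂ (y∈q , y∉p∪⁅x⁆) =
    x∈p∧x≢y⇒x∈p-y (x∈p△q⁺ʳ y∈q (y∉p∪⁅x⁆ ∘ p⊆p∪q ⁅ x ⁆)) λ { refl → y∉p∪⁅x⁆ (q⊆p∪q p ⁅ x ⁆ (x∈⁅x⁆ x)) }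
  ... | inj₁ (y∈p∪⁅x⁆ , y∉q) with x∈p∪⁅y⁆⁻ y∈p∪⁅x⁆
  ...   | inj₁ y∈p = x∈p∧x≢y⇒x∈p-y (x∈p△q⁺ˡ y∈p y∉q) λ { refl → y∉q x∈q }
  ...   | inj₂ refl = contradiction x∈q y∉q

∣p-x△q∣<∣p△q∣ : x ∈ p → x ∉ q → ∣ (p - x) △ q ∣ < ∣ p △ q ∣
∣p-x△q∣<∣p△q∣ {x = x} {p = p} {q = q} x∈p x∉q =
  ≤-<-trans (p⊆q⇒∣p∣≤∣q∣ ⊆p△q-x) (x∈p⇒∣p-x∣<∣p∣ (x∈p△q⁺ˡ x∈p x∉q))
  where
  ⊆p△q-x : (p - x) △ q ⊆ (p △ q) - x
  ⊆p△q-x {y} y∈ with x∈p△q⁻ y∈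
  ... | inj₁ (y∈p-x , y∉q) = let y∈p , y≢x = x∈p-y⁻ y∈p-x in x∈p∧x≢y⇒x∈p-y (x∈p△q⁺ˡ y∈p y∉q) y≢x
  ... | inj₂ (y∈q , y∉p-x) with y ≟ᶠ x
  ...   | yes refl = contradiction y∈q x∉q
  ...   | no y≢x   = x∈p∧x≢y⇒x∈p-y (x∈p△q⁺ʳ y∈q (y∉p-x ∘ λ y∈p → x∈p∧x≢y⇒x∈p-y y∈p y≢x)) y≢x

module _ {a ℓ₁ ℓ₂} (O : TotalPreorder a ℓ₁ ℓ₂) where
  open TotalPreorder O using (_≲_; total) renaming (Carrier to A; refl to ≲-refl; trans to ≲-trans)

  argmin : (f : Fin n → A) (p : Subset n) → Nonempty p →
           ∃ λ m → m ∈ p × (∀ {x} → x ∈ p → f m ≲ f x)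
  argmin f (outside ∷ p) (suc i , there i∈p) with argmin (f ∘ suc) p (i , i∈p)
  ... | m , m∈p , least = suc m , there m∈p , λ { (there x∈p) → least x∈p }
  argmin f (inside ∷ p) _ with nonempty? p
  ... | no p-empty = zero , here , λ { here → ≲-refl ; (there x∈p) → contradiction (_ , x∈p) p-empty }
  ... | yes p-nonempty with argmin (f ∘ suc) p p-nonempty
  ...   | m , m∈p , least with total (f zero) (f (suc m))
  ...     | inj₁ f0≲fm = zero , here , λ { here → ≲-refl ; (there x∈p) → ≲-trans f0≲fm (least x∈p) }
  ...     | inj₂ fm≲f0 = suc m , there m∈p , λ { here → fm≲f0 ; (there x∈p) → least x∈p }

module _ {ℓ} {P : Pred (Fin n) ℓ} (P? : Decidable P) where

  select : Subset n
  select = tabulate (does ∘ P?)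

  ∈-select⁺ : P x → x ∈ select
  ∈-select⁺ {x} px = lookup⇒[]= x select (≡.trans (lookup∘tabulate (does ∘ P?) x) (dec-true (P? x) px))

  ∈-select⁻ : x ∈ select → P x
  ∈-select⁻ {x} x∈ with P? x | ≡.trans (≡.sym (lookup∘tabulate (does ∘ P?) x)) ([]=⇒lookup x∈)
  ... | yes px | _  = px
  ... | no _   | ()

colorable-⊆ : ∀ {G : Graph n} {c} → p ⊆ q → Colorable G c q → Colorable G c p
colorable-⊆ p⊆q (f , proper) = f , λ i j i∈p j∈p → proper i j (p⊆q i∈p) (p⊆q j∈p)

unused-color : ∀ {m} (f : Fin n → Fin m) (p : Subset n) → ∣ p ∣ < m → ∃ λ j → ∀ {x} → x ∈ p → f x ≢ j
unused-color {m = m} f p ∣p∣<m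
  with ¬∀⟶∃¬ m (λ j → ∃ λ x → x ∈ p × f x ≡ j) (λ j → any? λ x → x ∈? p ×-dec f x ≟ᶠ j) ¬surjective
  where
  ¬surjective : ¬ (∀ j → ∃ λ x → x ∈ p × f x ≡ j)
  ¬surjective preimage = contradiction ∣p∣<m (≤⇒≯ (subst (_≤ ∣ p ∣) (∣⊤∣≡n m)
    (injective⇒∣p∣≤∣q∣ (proj₁ ∘ preimage) (λ {j} _ → proj₁ (proj₂ (preimage j))) injective)))
    where
    injective : ∀ {i j} → i ∈ ⊤ → j ∈ ⊤ → proj₁ (preimage i) ≡ proj₁ (preimage j) → i ≡ j
    injective {i} {j} _ _ eq =
      ≡.trans (≡.sym (proj₂ (proj₂ (preimage i)))) (≡.trans (cong f eq) (proj₂ (proj₂ (preimage j))))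
... | j , unused = j , λ x∈p fx≡j → unused (_ , x∈p , fx≡j)

module _ {k : ℕ} where

  TARStep-sym : TARStep k p q → TARStep k q p
  TARStep-sym {p = p} {q = q} (k≤p , k≤q , ∣p△q∣≡1) = k≤q , k≤p , ≡.trans (∣p△q∣≡∣q△p∣ q p) ∣p△q∣≡1

  insert-step : k ≤ ∣ p ∣ → x ∉ p → TARStep k p (p ∪ ⁅ x ⁆)
  insert-step {p = p} {x = x} k≤p x∉p = k≤p , ≤-trans k≤p (∣p∣≤∣p∪q∣ p ⁅ x ⁆) , ∣p△p∪⁅x⁆∣≡1 x∉p

  delete-step : k < ∣ p ∣ → x ∈ p → TARStep k p (p - x)
  delete-step {p = p} {x = x} k<p x∈p = <⇒≤ k<p , m<∣p∣⇒m≤∣p-x∣ p x k<p , ∣p△p-x∣≡1 x∈p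

module _ {G : Graph n} {c k : ℕ} where

  snoc : ∀ {S T U ℓ} → TARSeq G c k S T ℓ → TARStep k T U → Colorable G c U → TARSeq G c k S U (suc ℓ)
  snoc [ cS ]          st cU = (cS ∷ st) [ cU ]
  snoc ((cS ∷ st′) ss) st cU = (cS ∷ st′) (snoc ss st cU)

  reverse : ∀ {S T ℓ} → TARSeq G c k S T ℓ → TARSeq G c k T S ℓ
  reverse [ cS ]         = [ cS ]
  reverse {S} ((_∷_ {T = T} cS st) ss) = snoc (reverse ss) (TARStep-sym {p = S} {q = T} st) cS

  ∣△∣≤length : ∀ {S T ℓ} → TARSeq G c k S T ℓ → ∣ S △ T ∣ ≤ ℓ
  ∣△∣≤length {S} [ _ ] = ≤-reflexive (∣p△p∣≡0 S)
  ∣△∣≤length {S} {U} {suc ℓ} ((_∷_ {T = T} _ (_ , _ , ∣S△T∣≡1)) ss) = begin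
    ∣ S △ U ∣              ≤⟨ ∣p△r∣≤∣p△q∣+∣q△r∣ S T U ⟩
    ∣ S △ T ∣ + ∣ T △ U ∣  ≡⟨ cong (_+ ∣ T △ U ∣) ∣S△T∣≡1 ⟩
    suc ∣ T △ U ∣          ≤⟨ s≤s (∣△∣≤length ss) ⟩
    suc ℓ                  ∎
    where open ≤-Reasoning

module IntervalGraph {n} {G : Graph n} (IG : IsIntervalGraph G) where

  private
    I = proj₁ IG
    l r : Fin n → ℚ
    l = left I
    r = right I

  adj⇒meet : ∀ {i j} → Adj G i j → Meet I i j
  adj⇒meet {i} {j} = proj₂ ∘ proj₁ (proj₂ IG i j)

  meet⇒adj : ∀ {i j} → i ≢ j → Meet I i j → Adj G i j
  meet⇒adj {i} {j} i≢j = proj₂ (proj₂ IG i j) ∘ (i≢j ,_)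

  Covers : Fin n → ℚ → Set
  Covers i t = l i ℚ.≤ t × t ℚ.≤ r i

  covers-meet : ∀ {i j t} → Covers i t → Covers j t → Meet I i j
  covers-meet (li≤t , t≤ri) (lj≤t , t≤rj) = ℚ.≤-trans li≤t t≤rj , ℚ.≤-trans lj≤t t≤ri

  covers? : ∀ i t → Dec (Covers i t)
  covers? i t = l i ℚ.≤? t ×-dec t ℚ.≤? r i

  -- Opaque so that S and t can be inferred from stab S t.
  opaque
    stab : Subset n → ℚ → Subset n
    stab S t = S ∩ select (λ i → covers? i t)

    ∈-stab⁺ : ∀ {S t i} → i ∈ S → Covers i t → i ∈ stab S t
    ∈-stab⁺ {t = t} i∈S covers = x∈p∩q⁺ (i∈S , ∈-select⁺ (λ i → covers? i t) covers)

    ∈-stab⁻ : ∀ {S t i} → i ∈ stab S t → i ∈ S × Covers i t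
    ∈-stab⁻ {S} {t} i∈ = map₂ (∈-select⁻ (λ i → covers? i t)) (x∈p∩q⁻ S _ i∈)

  stab-mono : ∀ {S S′} t → S ⊆ S′ → stab S t ⊆ stab S′ t
  stab-mono t S⊆S′ i∈ = let i∈S , covers = ∈-stab⁻ i∈ in ∈-stab⁺ (S⊆S′ i∈S) covers

  colorable⇒∣stab∣≤c : ∀ {c S} → Colorable G c S → ∀ t → ∣ stab S t ∣ ≤ c
  colorable⇒∣stab∣≤c {c} {S} (f , proper) t =
    subst (∣ stab S t ∣ ≤_) (∣⊤∣≡n c) (injective⇒∣p∣≤∣q∣ f (const ∈⊤) injective)
    where
    injective : ∀ {i j} → i ∈ stab S t → j ∈ stab S t → f i ≡ f j → i ≡ j
    injective {i} {j} i∈ j∈ fi≡fj with i ≟ᶠ j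
    ... | yes i≡j = i≡j
    ... | no i≢j  =
      let i∈S , i-covers = ∈-stab⁻ i∈; j∈S , j-covers = ∈-stab⁻ j∈ in
      contradiction fi≡fj (proper i j i∈S j∈S (meet⇒adj i≢j (covers-meet i-covers j-covers)))

  extend-coloring : ∀ {c S m} → m ∈ S → (∀ {i} → i ∈ S → r m ℚ.≤ r i) → ∣ stab S (r m) ∣ ≤ c →
                    Colorable G c (S - m) → Colorable G c S
  extend-coloring {c} {S} {m} m∈S m-first thin (f , proper) = f′ , proper′
    where
    N = stab (S - m) (r m)

    ∣N∣<c : ∣ N ∣ < c
    ∣N∣<c = begin-strict
      ∣ N ∣                ≤⟨ p⊆q⇒∣p∣≤∣q∣ N⊆ ⟩
      ∣ stab S (r m) - m ∣ <⟨ x∈p⇒∣p-x∣<∣p∣ (∈-stab⁺ m∈S (l≤r m , ℚ.≤-refl)) ⟩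
      ∣ stab S (r m) ∣     ≤⟨ thin ⟩
      c                    ∎
      where
      open ≤-Reasoning
      l≤r = wf I
      N⊆ : N ⊆ stab S (r m) - m
      N⊆ i∈N = let i∈S-m , covers = ∈-stab⁻ i∈N; i∈S , i≢m = x∈p-y⁻ i∈S-m in
        x∈p∧x≢y⇒x∈p-y (∈-stab⁺ i∈S covers) i≢m

    j = proj₁ (unused-color f N ∣N∣<c)
    f′ = updateAt f m (const j)

    -- Every neighbour of m starts before r m (they meet) and ends after it (m ends first).
    neighbour∈N : ∀ {i} → i ∈ S → i ≢ m → Adj G m i → i ∈ N
    neighbour∈N i∈S i≢m adj = ∈-stab⁺ (x∈p∧x≢y⇒x∈p-y i∈S i≢m) (proj₂ (adj⇒meet adj) , m-first i∈S)

    f′-m : f′ m ≡ j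
    f′-m = updateAt-updates m f

    f′-other : ∀ {i} → i ≢ m → f′ i ≡ f i
    f′-other {i} i≢m = updateAt-minimal i m f i≢m

    proper-at-m : ∀ {i} → i ∈ S → i ≢ m → Adj G m i → f′ m ≢ f′ i
    proper-at-m i∈S i≢m adj f′m≡f′i =
      proj₂ (unused-color f N ∣N∣<c) (neighbour∈N i∈S i≢m adj)
        (≡.trans (≡.sym (f′-other i≢m)) (≡.trans (≡.sym f′m≡f′i) f′-m))

    proper′ : ∀ i i′ → i ∈ S → i′ ∈ S → Adj G i i′ → f′ i ≢ f′ i′
    proper′ i i′ i∈S i′∈S adj with i ≟ᶠ m | i′ ≟ᶠ m
    ... | yes refl | yes refl = contradiction adj (irrefl G)
    ... | yes refl | no i′≢m  = proper-at-m i′∈S i′≢m adj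
    ... | no i≢m   | yes refl = proper-at-m i∈S i≢m (Graph.sym G adj) ∘ ≡.sym
    ... | no i≢m   | no i′≢m  = λ f′i≡f′i′ →
      proper i i′ (x∈p∧x≢y⇒x∈p-y i∈S i≢m) (x∈p∧x≢y⇒x∈p-y i′∈S i′≢m) adj
        (≡.trans (≡.sym (f′-other i≢m)) (≡.trans f′i≡f′i′ (f′-other i′≢m)))

  greedy-coloring : ∀ {c S} → Fin c → Acc _⊂_ S →
                    (∀ {i} → i ∈ S → ∣ stab S (r i) ∣ ≤ c) → Colorable G c S
  greedy-coloring {c} {S} j₀ (acc rec) thin with nonempty? S
  ... | no S-empty = const j₀ , λ i _ i∈S → contradiction (i , i∈S) S-empty
  ... | yes S-nonempty with argmin ℚ.≤-totalPreorder r S S-nonempty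
  ...   | m , m∈S , m-first =
    extend-coloring m∈S m-first (thin m∈S) (greedy-coloring j₀ (rec (x∈p⇒p-x⊂p m∈S)) thin-rest)
    where
    thin-rest : ∀ {i} → i ∈ S - m → ∣ stab (S - m) (r i) ∣ ≤ c
    thin-rest i∈S-m = ≤-trans (p⊆q⇒∣p∣≤∣q∣ (stab-mono _ (p─q⊆p S ⁅ m ⁆))) (thin (p─q⊆p S ⁅ m ⁆ i∈S-m))

  ∣stab∣≤c⇒colorable : ∀ {c S} → 1 ≤ c → (∀ {i} → i ∈ S → ∣ stab S (r i) ∣ ≤ c) → Colorable G c S
  ∣stab∣≤c⇒colorable 1≤c = greedy-coloring (fromℕ< 1≤c) (⊂-wellFounded _)

  colorable? : ∀ {c} → 1 ≤ c → Decidable (Colorable G c)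
  colorable? {c} 1≤c S =
    map′ (λ thin → ∣stab∣≤c⇒colorable 1≤c (thin _)) (λ col i _ → colorable⇒∣stab∣≤c col (r i))
         (all? λ i → i ∈? S →-dec ∣ stab S (r i) ∣ ≤? c)

  -- Depth at t: beyond r u it is bounded by B; between l v and r u, u replaces v, which covers t;
  -- left of l v no interval of B \ A reaches t, so only intervals of A remain.
  exchange-colorable : ∀ {c A B u v} → 1 ≤ c → Colorable G c A → Colorable G c B →
             u ∈ A → u ∉ B → v ∈ B → v ∉ A →
             (∀ {w} → w ∈ B → w ∉ A → r u ℚ.≤ r w) →
             (∀ {w} → w ∈ B → w ∉ A → l v ℚ.≤ l w) →
             Colorable G c ((B - v) ∪ ⁅ u ⁆)
  exchange-colorable {c} {A} {B} {u} {v} 1≤c colA colB u∈A u∉B v∈B v∉A u-first v-first =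
    ∣stab∣≤c⇒colorable 1≤c λ {i} _ → thin (r i)
    where
    B′ = (B - v) ∪ ⁅ u ⁆

    thin : ∀ t → ∣ stab B′ t ∣ ≤ c
    thin t with t ℚ.≤? r u | l v ℚ.≤? t
    ... | no t≰ru | _ = ≤-trans (p⊆q⇒∣p∣≤∣q∣ stabB′⊆stabB) (colorable⇒∣stab∣≤c colB t)
      where
      stabB′⊆stabB : stab B′ t ⊆ stab B t
      stabB′⊆stabB i∈ with ∈-stab⁻ i∈
      ... | i∈B′ , covers with x∈p∪⁅y⁆⁻ i∈B′
      ...   | inj₁ i∈B-v = ∈-stab⁺ (proj₁ (x∈p-y⁻ i∈B-v)) covers
      ...   | inj₂ refl  = contradiction (proj₂ covers) t≰ru
    ... | yes t≤ru | yes lv≤t = begin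
      ∣ stab B′ t ∣           ≤⟨ ∣p∣≤1+∣p-x∣ (stab B′ t) u ⟩
      suc ∣ stab B′ t - u ∣   ≤⟨ s≤s (p⊆q⇒∣p∣≤∣q∣ swap) ⟩
      suc ∣ stab B t - v ∣    ≤⟨ x∈p⇒∣p-x∣<∣p∣ v∈stabB ⟩
      ∣ stab B t ∣            ≤⟨ colorable⇒∣stab∣≤c colB t ⟩
      c                       ∎
      where
      open ≤-Reasoning
      v∈stabB : v ∈ stab B t
      v∈stabB = ∈-stab⁺ v∈B (lv≤t , ℚ.≤-trans t≤ru (u-first v∈B v∉A))
      swap : stab B′ t - u ⊆ stab B t - v
      swap i∈ with x∈p-y⁻ i∈
      ... | i∈stabB′ , i≢u with ∈-stab⁻ i∈stabB′
      ...   | i∈B′ , covers with x∈p∪⁅y⁆⁻ i∈B′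
      ...     | inj₂ i≡u   = contradiction i≡u i≢u
      ...     | inj₁ i∈B-v = let i∈B , i≢v = x∈p-y⁻ i∈B-v in x∈p∧x≢y⇒x∈p-y (∈-stab⁺ i∈B covers) i≢v
    ... | yes _ | no lv≰t = ≤-trans (p⊆q⇒∣p∣≤∣q∣ stabB′⊆stabA) (colorable⇒∣stab∣≤c colA t)
      where
      stabB′⊆stabA : stab B′ t ⊆ stab A t
      stabB′⊆stabA {i} i∈ with ∈-stab⁻ i∈
      ... | i∈B′ , covers with x∈p∪⁅y⁆⁻ i∈B′ | i ∈? A
      ...   | inj₂ refl  | _       = ∈-stab⁺ u∈A covers
      ...   | inj₁ _     | yes i∈A = ∈-stab⁺ i∈A covers
      ...   | inj₁ i∈B-v | no i∉A  =
        contradiction (ℚ.≤-trans (v-first (proj₁ (x∈p-y⁻ i∈B-v)) i∉A) (proj₁ covers)) lv≰t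

  module Reconfiguration {c} (1≤c : 1 ≤ c) (k : ℕ) where

    Extendable : Subset n → Subset n → Set
    Extendable S T = ∃ λ v → v ∈ T × v ∉ S × Colorable G c (S ∪ ⁅ v ⁆)

    extendable? : ∀ S T → Dec (Extendable S T)
    extendable? S T = any? λ v → v ∈? T ×-dec ¬? (v ∈? S) ×-dec colorable? 1≤c (S ∪ ⁅ v ⁆)

    -- Constructive counterpart of ¬ Locked G c k (S ∪ T) S.
    record Unlocked (S T : Subset n) : Set where
      constructor unlocked
      field
        colorable : Colorable G c S
        k≤∣S∣     : k ≤ ∣ S ∣
        slack     : k < ∣ S ∣ ⊎ Extendable S T
    open Unlocked

    ¬Locked⇒Unlocked : ∀ {S T} → Colorable G c S → k ≤ ∣ S ∣ → ¬ Locked G c k (S ∪ T) S → Unlocked S T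
    ¬Locked⇒Unlocked {S} {T} colS k≤∣S∣ ¬locked = unlocked colS k≤∣S∣ slack′
      where
      maximal : ¬ Extendable S T → ∀ U → U ⊆ S ∪ T → S ⊆ U → Colorable G c U → U ⊆ S
      maximal ¬extendable U U⊆S∪T S⊆U colU {x} x∈U with x ∈? S
      ... | yes x∈S = x∈S
      ... | no x∉S  =
        contradiction (x , x∈T , x∉S , colorable-⊆ {G = G} (p⊆q⇒p∪⁅x⁆⊆q S⊆U x∈U) colU) ¬extendable
        where x∈T = Sum.[ (λ x∈S → contradiction x∈S x∉S) , id ] (x∈p∪q⁻ S T (U⊆S∪T x∈U))

      slack′ : k < ∣ S ∣ ⊎ Extendable S T
      slack′ with k ≟ ∣ S ∣ | extendable? S T
      ... | no k≢∣S∣ | _               = inj₁ (≤∧≢⇒< k≤∣S∣ k≢∣S∣)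
      ... | yes _    | yes extendable  = inj₂ extendable
      ... | yes k≡∣S∣ | no ¬extendable =
        contradiction (((λ {_} → p⊆p∪q T) , colS , maximal ¬extendable) , ≡.sym k≡∣S∣) ¬locked

    Unlocked-⊆ : ∀ {S T T′} → T ⊆ T′ → Unlocked S T → Unlocked S T′
    Unlocked-⊆ T⊆T′ (unlocked colS k≤∣S∣ (inj₁ k<∣S∣)) = unlocked colS k≤∣S∣ (inj₁ k<∣S∣)
    Unlocked-⊆ T⊆T′ (unlocked colS k≤∣S∣ (inj₂ (v , v∈T , ext))) =
      unlocked colS k≤∣S∣ (inj₂ (v , T⊆T′ v∈T , ext))

    large⇒Unlocked : ∀ {S T} → Colorable G c S → k < ∣ S ∣ → Unlocked S T
    large⇒Unlocked colS k<∣S∣ = unlocked colS (<⇒≤ k<∣S∣) (inj₁ k<∣S∣)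

    ShortPath : Subset n → Subset n → Set
    ShortPath S T = ∃ λ ℓ → ℓ ≤ ∣ S △ T ∣ × TARSeq G c k S T ℓ

    prepend : ∀ {S S₁ T} → Colorable G c S → TARStep k S S₁ → ∣ S₁ △ T ∣ < ∣ S △ T ∣ →
              ShortPath S₁ T → ShortPath S T
    prepend colS step closer (ℓ , ℓ≤ , path) = suc ℓ , <-≤-trans (s≤s ℓ≤) closer , (colS ∷ step) path

    reverse-path : ∀ {S T} → ShortPath S T → ShortPath T S
    reverse-path {S} {T} (ℓ , ℓ≤ , path) = ℓ , ≤-trans ℓ≤ (≤-reflexive (∣p△q∣≡∣q△p∣ S T)) , reverse path

    ReconfigurableBelow : ℕ → Set
    ReconfigurableBelow d = ∀ {S T} → ∣ S △ T ∣ < d → Unlocked S T → Unlocked T S → ShortPath S T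

    ReconfigurableBelow-swap : ∀ {S T : Subset n} →
                               ReconfigurableBelow ∣ S △ T ∣ → ReconfigurableBelow ∣ T △ S ∣
    ReconfigurableBelow-swap {S} {T} = subst ReconfigurableBelow (∣p△q∣≡∣q△p∣ S T)

    grow : ∀ {S T} → ReconfigurableBelow ∣ S △ T ∣ → Unlocked S T → Unlocked T S →
           Extendable S T → ShortPath S T
    grow ih uS uT (v , v∈T , v∉S , colS∪v) =
      prepend (colorable uS) (insert-step (k≤∣S∣ uS) v∉S) closer
        (ih closer (large⇒Unlocked colS∪v k<∣S∪v∣) (Unlocked-⊆ (p⊆p∪q ⁅ v ⁆) uT))
      where
      closer = ∣p∪⁅x⁆△q∣<∣p△q∣ v∉S v∈T
      k<∣S∪v∣ = ≤-<-trans (k≤∣S∣ uS) (x∉p⇒∣p∣<∣p∪⁅x⁆∣ v∉S)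

    -- x ends first among S △ T; swap it in for the leftmost w ∈ S \ T, or simply add it if S ⊆ T.
    exchange-path : ∀ {S T x} → ReconfigurableBelow ∣ S △ T ∣ → Unlocked S T → Unlocked T S →
                    k < ∣ S ∣ → k < ∣ T ∣ → x ∈ T → x ∉ S →
                    (∀ {y} → y ∈ S → y ∉ T → r x ℚ.≤ r y) → ShortPath S T
    exchange-path {S} {T} {x} ih uS uT k<∣S∣ k<∣T∣ x∈T x∉S x-first with nonempty? (S ─ T)
    ... | no S─T-empty =
      grow ih uS uT (x , x∈T , x∉S , colorable-⊆ {G = G} (p⊆q⇒p∪⁅x⁆⊆q S⊆T x∈T) (colorable uT))
      where
      S⊆T : S ⊆ T
      S⊆T {y} y∈S with y ∈? T
      ... | yes y∈T = y∈T
      ... | no y∉T  = contradiction (y , x∈p∧x∉q⇒x∈p─q y∈S y∉T) S─T-empty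
    ... | yes S─T-nonempty with argmin ℚ.≤-totalPreorder l (S ─ T) S─T-nonempty
    ...   | w , w∈S─T , w-first =
      prepend (colorable uS) (delete-step k<∣S∣ w∈S) closer₁
        (prepend colS-w (insert-step k≤∣S-w∣ x∉S-w) closer₂
          (ih (<-trans closer₂ closer₁) (large⇒Unlocked colS′ k<∣S′∣)
              (large⇒Unlocked (colorable uT) k<∣T∣)))
      where
      w∈S = proj₁ (x∈p─q⁻ w∈S─T)
      w∉T = proj₂ (x∈p─q⁻ w∈S─T)
      x∉S-w = x∉S ∘ proj₁ ∘ x∈p-y⁻
      k≤∣S-w∣ = m<∣p∣⇒m≤∣p-x∣ S w k<∣S∣
      k<∣S′∣ = ≤-<-trans k≤∣S-w∣ (x∉p⇒∣p∣<∣p∪⁅x⁆∣ x∉S-w)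
      colS-w = colorable-⊆ {G = G} (p─q⊆p S ⁅ w ⁆) (colorable uS)
      colS′ = exchange-colorable 1≤c (colorable uT) (colorable uS) x∈T x∉S w∈S w∉T x-first
                (λ y∈S y∉T → w-first (x∈p∧x∉q⇒x∈p─q y∈S y∉T))
      closer₁ = ∣p-x△q∣<∣p△q∣ w∈S w∉T
      closer₂ = ∣p∪⁅x⁆△q∣<∣p△q∣ x∉S-w x∈T

    reconfigure-step : ∀ {S T} → ReconfigurableBelow ∣ S △ T ∣ →
                       Unlocked S T → Unlocked T S → ShortPath S T
    reconfigure-step {S} {T} ih uS uT with nonempty? (S △ T) | slack uS | slack uT
    ... | no S△T-empty | _ | _ =
      subst (ShortPath S) (Empty[p△q]⇒p≡q S△T-empty) (0 , z≤n , [ colorable uS ])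
    ... | yes _ | inj₂ extendable | _ = grow ih uS uT extendable
    ... | yes _ | _ | inj₂ extendable =
      reverse-path (grow (ReconfigurableBelow-swap {S} {T} ih) uT uS extendable)
    ... | yes S△T-nonempty | inj₁ k<∣S∣ | inj₁ k<∣T∣ with argmin ℚ.≤-totalPreorder r (S △ T) S△T-nonempty
    ...   | x , x∈S△T , x-first with x∈p△q⁻ x∈S△T
    ...     | inj₂ (x∈T , x∉S) =
      exchange-path ih uS uT k<∣S∣ k<∣T∣ x∈T x∉S λ y∈S y∉T → x-first (x∈p△q⁺ˡ y∈S y∉T)
    ...     | inj₁ (x∈S , x∉T) = reverse-path
      (exchange-path (ReconfigurableBelow-swap {S} {T} ih) uT uS k<∣T∣ k<∣S∣ x∈S x∉T
        λ y∈T y∉S → x-first (x∈p△q⁺ʳ y∈T y∉S))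

    reconfigure : ∀ {S T} → Acc _<_ ∣ S △ T ∣ → Unlocked S T → Unlocked T S → ShortPath S T
    reconfigure (acc rec) = reconfigure-step λ closer → reconfigure (rec closer)

lemma9 : ∀ {n} (G : Graph n) → IsIntervalGraph G →
    (c k : ℕ) → 1 ≤ c →
    (S S′ : Subset n) →
    Colorable G c S → Colorable G c S′ →
    k ≤ ∣ S ∣ → k ≤ ∣ S′ ∣ →
    ¬ Locked G c k (S ∪ S′) S → ¬ Locked G c k (S ∪ S′) S′ →
    DistEq G c k S S′ ∣ S △ S′ ∣
lemma9 G IG c k 1≤c S S′ colS colS′ k≤∣S∣ k≤∣S′∣ ¬lockedS ¬lockedS′ =
  let ℓ , ℓ≤∣S△S′∣ , path = reconfigure (<-wellFounded _) unlockedS unlockedS′ in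
  subst (TARSeq G c k S S′) (≤-antisym ℓ≤∣S△S′∣ (∣△∣≤length path)) path , λ _ → ∣△∣≤length
  where
  open IntervalGraph.Reconfiguration IG 1≤c k
  unlockedS = ¬Locked⇒Unlocked colS k≤∣S∣ ¬lockedS
  unlockedS′ = ¬Locked⇒Unlocked colS′ k≤∣S′∣ (subst (λ H → ¬ Locked G c k H S′) (∪-comm S S′) ¬lockedS′)
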